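{- Let $G$ and $H$ be two almost controllable graphs on $n$ vertices having the same generalized spectrum, and let $Q_1\ne Q_2$ be the two rational regular orthogonal matrices $Q$ satisfying $Q^TA(G)Q=A(H)$. Then $Q_1$ and $Q_2$ are column permutation equivalent if and only if $H$ is symmetric.
   Context: Graphs are simple, undirected; $A(G)$ is the adjacency matrix, $e$ the all-ones vector, $W(G)=[e,A(G)e,\ldots,A(G)^{n-1}e]$; $G$ is almost controllable if $\mathrm{rank}\,W(G)=n-1$. The generalized spectrum of $G$ is the spectrum of $G$ together with that of its complement. A matrix $Q$ is regular orthogonal if $Q^TQ=I$ and $Qe=e$. It is known that if $G$ is almost controllable and $H$ has the same generalized spectrum, then the equation $Q^TA(G)Q=A(H)$ has exactly two solutions $Q$ among regular orthogonal matrices, both rational. Matrices $Q_1,Q_2$ are column permutation equivalent if $Q_2=Q_1P$ for some permutation matrix $P$. A graph is symmetric if its automorphism group is nontrivial, and asymmetric otherwise. -}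

module Defs where

open import Data.Nat using (ℕ; zero; suc; _∸_)
open import Data.Fin using (Fin; zero; suc; toℕ; punchIn; _≟_)
open import Data.Fin.Permutation using (Permutation′; _⟨$⟩ʳ_)
open import Data.Bool using (Bool; true; false; if_then_else_; not; _∧_)
open import Data.Rational using (ℚ; 0ℚ; 1ℚ; _+_; _*_; -_; _-_)
open import Data.Product using (Σ; ∃; _×_; _,_)
open import Relation.Binary.PropositionalEquality using (_≡_; _≢_)
open import Relation.Nullary using (¬_)
open import Relation.Nullary.Decidable using (⌊_⌋)

record Graph (n : ℕ) : Set where
  field
    adj   : Fin n → Fin n → Bool
    sym   : ∀ i j → adj i j ≡ adj j i
    irrefl : ∀ i → adj i i ≡ false
open Graph public

compAdj : ∀ {n} → Graph n → Fin n → Fin n → Bool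
compAdj G i j = not (adj G i j) ∧ not ⌊ i ≟ j ⌋

Mat : ℕ → ℕ → Set
Mat m k = Fin m → Fin k → ℚ

Vec : ℕ → Set
Vec n = Fin n → ℚ

sumℚ : ∀ n → (Fin n → ℚ) → ℚ
sumℚ zero    f = 0ℚ
sumℚ (suc n) f = f zero + sumℚ n (λ i → f (suc i))

_·_ : ∀ {m k l} → Mat m k → Mat k l → Mat m l
_·_ {k = k} M N i j = sumℚ k (λ t → M i t * N t j)

_⊙_ : ∀ {m k} → Mat m k → Vec k → Vec m
_⊙_ {k = k} M v i = sumℚ k (λ t → M i t * v t)

transpose : ∀ {m k} → Mat m k → Mat k m
transpose M i j = M j i

idMat : ∀ n → Mat n n
idMat n i j = if ⌊ i ≟ j ⌋ then 1ℚ else 0ℚ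

ones : ∀ n → Vec n
ones n i = 1ℚ

_≋_ : ∀ {m k} → Mat m k → Mat m k → Set
M ≋ N = ∀ i j → M i j ≡ N i j

boolℚ : Bool → ℚ
boolℚ true  = 1ℚ
boolℚ false = 0ℚ

A : ∀ {n} → Graph n → Mat n n
A G i j = boolℚ (adj G i j)

Acomp : ∀ {n} → Graph n → Mat n n
Acomp G i j = boolℚ (compAdj G i j)

powApply : ∀ {n} → Mat n n → ℕ → Vec n → Vec n
powApply M zero    v = v
powApply M (suc k) v = M ⊙ powApply M k v

W : ∀ {n} → Graph n → Mat n n
W {n} G i k = powApply (A G) (toℕ k) (ones n) i

LinIndepCols : ∀ {m k r} → Mat m k → (Fin r → Fin k) → Set
LinIndepCols {m} {k} {r} M f =
  ∀ (c : Fin r → ℚ) → (∀ i → sumℚ r (λ j → M i (f j) * c j) ≡ 0ℚ) → ∀ j → c j ≡ 0ℚ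

HasRank : ∀ {m k} → Mat m k → ℕ → Set
HasRank {m} {k} M r =
  (Σ (Fin r → Fin k) λ f → LinIndepCols M f) ×
  (∀ (f : Fin (suc r) → Fin k) → ¬ LinIndepCols M f)

AlmostControllable : ∀ {n} → Graph n → Set
AlmostControllable {n} G = HasRank (W G) (n ∸ 1)

sign : ∀ {n} → Fin n → ℚ
sign zero    = 1ℚ
sign (suc i) = - sign i

det : ∀ n → Mat n n → ℚ
det zero    M = 1ℚ
det (suc n) M =
  sumℚ (suc n) (λ j → sign j * (M zero j * det n (λ i k → M (suc i) (punchIn j k))))

charPolyAt : ∀ {n} → Mat n n → ℚ → ℚ
charPolyAt {n} M x = det n (λ i j → x * idMat n i j - M i j)

-- same spectrum = same characteristic polynomial (as a polynomial over ℚ;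
-- a polynomial over ℚ is determined by its values at all rationals)
Cospectral : ∀ {n} → Mat n n → Mat n n → Set
Cospectral M N = ∀ x → charPolyAt M x ≡ charPolyAt N x

SameGeneralizedSpectrum : ∀ {n} → Graph n → Graph n → Set
SameGeneralizedSpectrum G H = Cospectral (A G) (A H) × Cospectral (Acomp G) (Acomp H)

RegularOrthogonal : ∀ {n} → Mat n n → Set
RegularOrthogonal {n} Q = (transpose Q · Q) ≋ idMat n × (∀ i → (Q ⊙ ones n) i ≡ 1ℚ)

permMat : ∀ {n} → Permutation′ n → Mat n n
permMat π i j = if ⌊ i ≟ π ⟨$⟩ʳ j ⌋ then 1ℚ else 0ℚ

ColumnPermutationEquivalent : ∀ {n} → Mat n n → Mat n n → Set
ColumnPermutationEquivalent {n} Q₁ Q₂ = Σ (Permutation′ n) λ π → Q₂ ≋ (Q₁ · permMat π)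

IsAutomorphism : ∀ {n} → Graph n → Permutation′ n → Set
IsAutomorphism G σ = ∀ i j → adj G (σ ⟨$⟩ʳ i) (σ ⟨$⟩ʳ j) ≡ adj G i j

-- symmetric: automorphism group is nontrivial
Symmetric : ∀ {n} → Graph n → Set
Symmetric {n} G = Σ (Permutation′ n) λ σ → IsAutomorphism G σ × ∃ λ i → σ ⟨$⟩ʳ i ≢ i

-- Every regular orthogonal solution Q of Qᵀ A(G) Q = A(H) satisfies Qᵀ W(G) = W(H), so the
-- columns of two solutions differ by vectors orthogonal to the (n − 1)-dimensional column space
-- of W(G); hence all solutions are Q₁ + u aᵀ for one fixed vector u. Orthogonality of Q₁ + u aᵀ
-- forces (u·u) a = −2 Q₁ᵀu as soon as a ≠ 0, so Q₂ is the only solution besides Q₁. If σ is an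
-- automorphism of H moving a vertex, Q₁ P_σ is a solution different from Q₁, hence equal to Q₂;
-- conversely Q₂ = Q₁ P_π gives P_πᵀ A(H) P_π = A(H), and π ≠ id because Q₂ ≠ Q₁.

module Submission where

open import Defs hiding (sym)
open import Algebra.Bundles using (Ring)
open import Data.Bool using (true; false)
open import Data.Fin using (Fin; zero; suc; punchIn; toℕ; _≟_)
open import Data.Fin.Permutation using (Permutation′; _⟨$⟩ʳ_; _⟨$⟩ˡ_; inverseˡ)
open import Data.Fin.Properties using (punchInᵢ≢i; any?; all?; ¬∀⟶∃¬)
open import Data.Nat as ℕ using (ℕ; zero; suc; _∸_; z≤n; s≤s)
import Data.Nat.Properties as ℕ
open import Data.Product using (∃; ∃₂; _×_; _,_; proj₁; proj₂)
open import Data.Rational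
  using (ℚ; 0ℚ; 1ℚ; _+_; _*_; -_; _-_; 1/_; _≤_; NonZero; ≢-nonZero; nonNegative; nonPositive)
import Data.Rational.Properties as ℚ
open import Algebra.Properties.Group ℚ.+-0-group
  using (identityʳ-unique; inverseʳ-unique; x∙y⁻¹≈ε⇒x≈y; x≈y⇒x∙y⁻¹≈ε)
open import Algebra.Properties.Semiring.Sum (Ring.semiring ℚ.+-*-ring)
  using (sum; sum-cong-≗; sum-replicate-zero; ∑-distrib-+; ∑-comm; *-distribˡ-sum; *-distribʳ-sum;
         sum-remove; sum-permute)
open import Data.Sum using (inj₁; inj₂)
open import Data.Vec.Functional using (_∷_; insertAt)
open import Data.Vec.Functional.Properties using (insertAt-lookup; insertAt-punchIn)
open import Function using (_∘_)
open import Function.Bundles using (_⇔_; mk⇔)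
open import Level using (0ℓ)
open import Relation.Binary.PropositionalEquality
open import Relation.Nullary using (¬_; ¬?; Dec; yes; no; contradiction)
open import Relation.Nullary.Decidable using (decidable-stable; dec⇒maybe)
open import Tactic.RingSolver using (solve-∀)
open import Tactic.RingSolver.Core.AlmostCommutativeRing
  using (AlmostCommutativeRing; fromCommutativeRing)

-- Arithmetic in ℚ

ℚ-ring : AlmostCommutativeRing 0ℓ 0ℓ
ℚ-ring = fromCommutativeRing ℚ.+-*-commutativeRing (λ x → dec⇒maybe (0ℚ ℚ.≟ x))

≡-stable : ∀ {x y : ℚ} → ¬ ¬ x ≡ y → x ≡ y
≡-stable = decidable-stable (_ ℚ.≟ _)

x*y≡z⇒y≡z*1/x : ∀ x {y z} .{{_ : NonZero x}} → x * y ≡ z → y ≡ z * 1/ x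
x*y≡z⇒y≡z*1/x x {y} {z} xy≡z = begin
  y                ≡⟨ ℚ.*-identityʳ y ⟨
  y * 1ℚ           ≡⟨ cong (y *_) (ℚ.*-inverseʳ x) ⟨
  y * (x * 1/ x)   ≡⟨ reassociate y x (1/ x) ⟩
  (x * y) * 1/ x   ≡⟨ cong (_* 1/ x) xy≡z ⟩
  z * 1/ x         ∎
  where
  open ≡-Reasoning
  reassociate : ∀ a b c → a * (b * c) ≡ (b * a) * c
  reassociate = solve-∀ ℚ-ring

*-cancelˡ-≢0 : ∀ {x y z} → x ≢ 0ℚ → x * y ≡ x * z → y ≡ z
*-cancelˡ-≢0 {x} x≢0 xy≡xz = trans (x*y≡z⇒y≡z*1/x x xy≡xz) (sym (x*y≡z⇒y≡z*1/x x refl))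
  where instance _ = ≢-nonZero x≢0

x≢0∧x*y≡0⇒y≡0 : ∀ {x y} → x ≢ 0ℚ → x * y ≡ 0ℚ → y ≡ 0ℚ
x≢0∧x*y≡0⇒y≡0 {x} x≢0 xy≡0 = *-cancelˡ-≢0 x≢0 (trans xy≡0 (sym (ℚ.*-zeroʳ x)))

x*x≡0⇒x≡0 : ∀ x → x * x ≡ 0ℚ → x ≡ 0ℚ
x*x≡0⇒x≡0 x xx≡0 = ≡-stable (λ x≢0 → x≢0 (x≢0∧x*y≡0⇒y≡0 x≢0 xx≡0))

0≤x*x : ∀ x → 0ℚ ≤ x * x
0≤x*x x with ℚ.≤-total 0ℚ x
... | inj₁ 0≤x = ℚ.nonNegative⁻¹ (x * x)
      {{ℚ.nonNeg*nonNeg⇒nonNeg x {{nonNegative 0≤x}} x {{nonNegative 0≤x}}}}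
... | inj₂ x≤0 = ℚ.nonNegative⁻¹ (x * x)
      {{ℚ.nonPos*nonPos⇒nonPos x {{nonPositive x≤0}} x {{nonPositive x≤0}}}}

0≤x∧0≤y∧x+y≡0⇒x≡0 : ∀ {x y} → 0ℚ ≤ x → 0ℚ ≤ y → x + y ≡ 0ℚ → x ≡ 0ℚ
0≤x∧0≤y∧x+y≡0⇒x≡0 {x} {y} 0≤x 0≤y x+y≡0 = ℚ.≤-antisym x≤0 0≤x
  where
  x≤0 : x ≤ 0ℚ
  x≤0 = ℚ.≤-trans (ℚ.≤-reflexive (sym (ℚ.+-identityʳ x)))
          (ℚ.≤-trans (ℚ.+-monoʳ-≤ x 0≤y) (ℚ.≤-reflexive x+y≡0))

-- Finite sums

sumℚ≡sum : ∀ n (f : Fin n → ℚ) → sumℚ n f ≡ sum f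
sumℚ≡sum zero    f = refl
sumℚ≡sum (suc n) f = cong (f zero +_) (sumℚ≡sum n (f ∘ suc))

sumℚ-cong : ∀ n {f g : Fin n → ℚ} → (∀ i → f i ≡ g i) → sumℚ n f ≡ sumℚ n g
sumℚ-cong n {f} {g} f≗g =
  trans (sumℚ≡sum n f) (trans (sum-cong-≗ f≗g) (sym (sumℚ≡sum n g)))

sumℚ-0 : ∀ n {f : Fin n → ℚ} → (∀ i → f i ≡ 0ℚ) → sumℚ n f ≡ 0ℚ
sumℚ-0 n f≗0 = trans (sumℚ-cong n f≗0) (trans (sumℚ≡sum n _) (sum-replicate-zero n))

sumℚ-+ : ∀ n (f g : Fin n → ℚ) → sumℚ n (λ i → f i + g i) ≡ sumℚ n f + sumℚ n g
sumℚ-+ n f g = begin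
  sumℚ n (λ i → f i + g i)  ≡⟨ sumℚ≡sum n _ ⟩
  sum (λ i → f i + g i)     ≡⟨ ∑-distrib-+ f g ⟩
  sum f + sum g             ≡⟨ cong₂ _+_ (sumℚ≡sum n f) (sumℚ≡sum n g) ⟨
  sumℚ n f + sumℚ n g       ∎
  where open ≡-Reasoning

sumℚ-*ˡ : ∀ n c (f : Fin n → ℚ) → c * sumℚ n f ≡ sumℚ n (λ i → c * f i)
sumℚ-*ˡ n c f = begin
  c * sumℚ n f             ≡⟨ cong (c *_) (sumℚ≡sum n f) ⟩
  c * sum f                ≡⟨ *-distribˡ-sum c f ⟩
  sum (λ i → c * f i)      ≡⟨ sumℚ≡sum n _ ⟨
  sumℚ n (λ i → c * f i)   ∎
  where open ≡-Reasoning

sumℚ-*ʳ : ∀ n c (f : Fin n → ℚ) → sumℚ n f * c ≡ sumℚ n (λ i → f i * c)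
sumℚ-*ʳ n c f = begin
  sumℚ n f * c             ≡⟨ cong (_* c) (sumℚ≡sum n f) ⟩
  sum f * c                ≡⟨ *-distribʳ-sum c f ⟩
  sum (λ i → f i * c)      ≡⟨ sumℚ≡sum n _ ⟨
  sumℚ n (λ i → f i * c)   ∎
  where open ≡-Reasoning

sumℚ-+-* : ∀ n c (f g : Fin n → ℚ) → sumℚ n (λ i → f i + c * g i) ≡ sumℚ n f + c * sumℚ n g
sumℚ-+-* n c f g = trans (sumℚ-+ n f _) (cong (sumℚ n f +_) (sym (sumℚ-*ˡ n c g)))

sumℚ-comm : ∀ m n (f : Fin m → Fin n → ℚ) →
            sumℚ m (λ i → sumℚ n (f i)) ≡ sumℚ n (λ j → sumℚ m (λ i → f i j))
sumℚ-comm m n f = begin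
  sumℚ m (λ i → sumℚ n (f i))          ≡⟨ sumℚ≡sum m _ ⟩
  sum (λ i → sumℚ n (f i))             ≡⟨ sum-cong-≗ {m} (λ i → sumℚ≡sum n (f i)) ⟩
  sum (λ i → sum (f i))                ≡⟨ ∑-comm f ⟩
  sum (λ j → sum (λ i → f i j))        ≡⟨ sum-cong-≗ {n} (λ j → sumℚ≡sum m _) ⟨
  sum (λ j → sumℚ m (λ i → f i j))     ≡⟨ sumℚ≡sum n _ ⟨
  sumℚ n (λ j → sumℚ m (λ i → f i j))  ∎
  where open ≡-Reasoning

sumℚ-remove : ∀ n (p : Fin (suc n)) (f : Fin (suc n) → ℚ) →
              sumℚ (suc n) f ≡ f p + sumℚ n (f ∘ punchIn p)
sumℚ-remove n p f = begin
  sumℚ (suc n) f               ≡⟨ sumℚ≡sum (suc n) f ⟩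
  sum f                        ≡⟨ sum-remove f ⟩
  f p + sum (f ∘ punchIn p)    ≡⟨ cong (f p +_) (sumℚ≡sum n _) ⟨
  f p + sumℚ n (f ∘ punchIn p) ∎
  where open ≡-Reasoning

sumℚ-single : ∀ n (k : Fin n) (f : Fin n → ℚ) → (∀ j → j ≢ k → f j ≡ 0ℚ) → sumℚ n f ≡ f k
sumℚ-single (suc n) k f vanishes = begin
  sumℚ (suc n) f                ≡⟨ sumℚ-remove n k f ⟩
  f k + sumℚ n (f ∘ punchIn k)  ≡⟨ cong (f k +_) (sumℚ-0 n (λ j → vanishes _ (punchInᵢ≢i k j))) ⟩
  f k + 0ℚ                      ≡⟨ ℚ.+-identityʳ (f k) ⟩
  f k                           ∎
  where open ≡-Reasoning

sumℚ-permute : ∀ n (f : Fin n → ℚ) (π : Permutation′ n) → sumℚ n f ≡ sumℚ n (f ∘ (π ⟨$⟩ʳ_))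
sumℚ-permute n f π =
  trans (sumℚ≡sum n f) (trans (sum-permute f π) (sym (sumℚ≡sum n _)))

-- Linear independence in ℚⁿ

dot : ∀ {n} → Vec n → Vec n → ℚ
dot {n} x y = sumℚ n (λ i → x i * y i)

col : ∀ {m k} → Mat m k → Fin k → Vec m
col M j i = M i j

dot-comm : ∀ {n} (x y : Vec n) → dot x y ≡ dot y x
dot-comm {n} x y = sumℚ-cong n (λ i → ℚ.*-comm (x i) (y i))

dot-−ʳ : ∀ {n} (x y z : Vec n) → dot x (λ i → y i - z i) ≡ dot x y - dot x z
dot-−ʳ {n} x y z = begin
  sumℚ n (λ i → x i * (y i - z i))                ≡⟨ sumℚ-cong n (λ i → distrib (x i) (y i) (z i)) ⟩
  sumℚ n (λ i → x i * y i + - 1ℚ * (x i * z i))   ≡⟨ sumℚ-+-* n (- 1ℚ) _ _ ⟩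
  dot x y + - 1ℚ * dot x z                        ≡⟨ unit (dot x y) (dot x z) ⟩
  dot x y - dot x z                               ∎
  where
  open ≡-Reasoning
  distrib : ∀ a b c → a * (b - c) ≡ a * b + - 1ℚ * (a * c)
  distrib = solve-∀ ℚ-ring
  unit : ∀ a b → a + - 1ℚ * b ≡ a - b
  unit = solve-∀ ℚ-ring

dot-*ʳ : ∀ {n} (x : Vec n) c (y : Vec n) → dot x (λ i → c * y i) ≡ c * dot x y
dot-*ʳ {n} x c y = trans (sumℚ-cong n (λ i → swap (x i) c (y i))) (sym (sumℚ-*ˡ n c _))
  where swap : ∀ a b d → a * (b * d) ≡ b * (a * d)
        swap = solve-∀ ℚ-ring

dot-self≡0⇒≡0 : ∀ {n} (x : Vec n) → dot x x ≡ 0ℚ → ∀ i → x i ≡ 0ℚ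
dot-self≡0⇒≡0 {suc n} x xx≡0 k = x*x≡0⇒x≡0 (x k)
  (0≤x∧0≤y∧x+y≡0⇒x≡0 (0≤x*x (x k)) (0≤sum-of-squares n (x ∘ punchIn k))
    (trans (sym (sumℚ-remove n k (λ i → x i * x i))) xx≡0))
  where
  0≤sum-of-squares : ∀ n (y : Vec n) → 0ℚ ≤ dot y y
  0≤sum-of-squares zero    y = ℚ.≤-refl
  0≤sum-of-squares (suc n) y = ℚ.≤-trans (ℚ.≤-reflexive (sym (ℚ.+-identityʳ 0ℚ)))
    (ℚ.+-mono-≤ (0≤x*x (y zero)) (0≤sum-of-squares n (y ∘ suc)))

lincomb : ∀ {k m} → (Fin k → Vec m) → (Fin k → ℚ) → Vec m
lincomb {k} v c i = sumℚ k (λ j → v j i * c j)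

LinIndep : ∀ {k m} → (Fin k → Vec m) → Set
LinIndep v = ∀ c → (∀ i → lincomb v c i ≡ 0ℚ) → ∀ j → c j ≡ 0ℚ

dot-lincomb : ∀ {k m} (x : Vec m) (v : Fin k → Vec m) (c : Fin k → ℚ) →
              dot x (lincomb v c) ≡ sumℚ k (λ j → dot x (v j) * c j)
dot-lincomb {k} {m} x v c = begin
  sumℚ m (λ i → x i * sumℚ k (λ j → v j i * c j))      ≡⟨ sumℚ-cong m (λ i → sumℚ-*ˡ k (x i) _) ⟩
  sumℚ m (λ i → sumℚ k (λ j → x i * (v j i * c j)))    ≡⟨ sumℚ-comm m k _ ⟩
  sumℚ k (λ j → sumℚ m (λ i → x i * (v j i * c j)))    ≡⟨ sumℚ-cong k (λ j → sumℚ-cong m (λ i →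
                                                             sym (ℚ.*-assoc (x i) (v j i) (c j)))) ⟩
  sumℚ k (λ j → sumℚ m (λ i → (x i * v j i) * c j))    ≡⟨ sumℚ-cong k (λ j → sumℚ-*ʳ m (c j) _) ⟨
  sumℚ k (λ j → dot x (v j) * c j)                      ∎
  where open ≡-Reasoning

module Elimination {m k} (v : Fin (suc k) → Vec (suc m)) (p : Fin (suc k)) (β : Fin k → ℚ)
                   (β-clears : ∀ j → v (punchIn p j) zero ≡ β j * v p zero) where

  residual : Fin k → Vec (suc m)
  residual j x = v (punchIn p j) x - β j * v p x

  reduced : Fin k → Vec m
  reduced j i = residual j (suc i)

  -- A dependency among the residuals lifts to one among v: the pivot's coefficient is chosen so
  -- that the β-multiples of v p cancel.
  lincomb-insertAt : ∀ c x →
    lincomb v (insertAt c p (- sumℚ k (λ j → β j * c j))) x ≡ lincomb residual c x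
  lincomb-insertAt c x = begin
    lincomb v C x                                        ≡⟨ sumℚ-remove k p (λ t → v t x * C t) ⟩
    v p x * C p + sumℚ k (λ j → v (punchIn p j) x * C (punchIn p j))
      ≡⟨ cong₂ (λ a b → v p x * a + b) (insertAt-lookup c p γ)
               (sumℚ-cong k (λ j → cong (v (punchIn p j) x *_) (insertAt-punchIn c p γ j))) ⟩
    v p x * γ + sumℚ k (λ j → v (punchIn p j) x * c j)
      ≡⟨ cong (v p x * γ +_) (sumℚ-cong k (λ j → split (v (punchIn p j) x) (β j) (v p x) (c j))) ⟩
    v p x * γ + sumℚ k (λ j → residual j x * c j + v p x * (β j * c j))
      ≡⟨ cong (v p x * γ +_) (sumℚ-+-* k (v p x) _ _) ⟩
    v p x * γ + (lincomb residual c x + v p x * sumℚ k (λ j → β j * c j))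
      ≡⟨ cancel (v p x) (lincomb residual c x) (sumℚ k (λ j → β j * c j)) ⟩
    lincomb residual c x                                 ∎
    where
    open ≡-Reasoning
    γ = - sumℚ k (λ j → β j * c j)
    C = insertAt c p γ
    split : ∀ w b a d → w * d ≡ (w - b * a) * d + a * (b * d)
    split = solve-∀ ℚ-ring
    cancel : ∀ a r s → a * - s + (r + a * s) ≡ r
    cancel = solve-∀ ℚ-ring

  reduced-linIndep : LinIndep v → LinIndep reduced
  reduced-linIndep v-indep c reduced-c≡0 j = begin
    c j                ≡⟨ insertAt-punchIn c p _ j ⟨
    C (punchIn p j)    ≡⟨ v-indep C v-C≡0 (punchIn p j) ⟩
    0ℚ                 ∎
    where
    open ≡-Reasoning
    C = insertAt c p (- sumℚ k (λ j → β j * c j))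
    residual-c≡0 : ∀ x → lincomb residual c x ≡ 0ℚ
    residual-c≡0 zero    = sumℚ-0 k (λ j → trans
      (cong (λ w → (w - β j * v p zero) * c j) (β-clears j))
      (trans (cong (_* c j) (ℚ.+-inverseʳ (β j * v p zero))) (ℚ.*-zeroˡ (c j))))
    residual-c≡0 (suc i) = reduced-c≡0 i
    v-C≡0 : ∀ x → lincomb v C x ≡ 0ℚ
    v-C≡0 x = trans (lincomb-insertAt c x) (residual-c≡0 x)

pivot : ∀ {m k} (v : Fin (suc k) → Vec (suc m)) →
        ∃₂ λ p (β : Fin k → ℚ) → ∀ j → v (punchIn p j) zero ≡ β j * v p zero
pivot {k = k} v with any? (λ p → ¬? (v p zero ℚ.≟ 0ℚ))
... | yes (p , a≢0) = p , (λ j → v (punchIn p j) zero * 1/ a) , λ j → rescale (v (punchIn p j) zero)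
  where
  a = v p zero
  instance _ = ≢-nonZero a≢0
  rescale : ∀ w → w ≡ (w * 1/ a) * a
  rescale w = begin
    w                ≡⟨ ℚ.*-identityʳ w ⟨
    w * 1ℚ           ≡⟨ cong (w *_) (ℚ.*-inverseˡ a) ⟨
    w * (1/ a * a)   ≡⟨ ℚ.*-assoc w (1/ a) a ⟨
    (w * 1/ a) * a   ∎
    where open ≡-Reasoning
... | no all≡0 = zero , (λ _ → 0ℚ) , λ j →
  trans (≡-stable (λ ≢0 → all≡0 (suc j , ≢0))) (sym (ℚ.*-zeroˡ (v zero zero)))

linIndep⇒≤ : ∀ {m k} (v : Fin k → Vec m) → LinIndep v → k ℕ.≤ m
linIndep⇒≤ {k = zero}  v v-indep = z≤n
linIndep⇒≤ {zero} {suc k} v v-indep = contradiction (v-indep (λ _ → 1ℚ) (λ ()) zero) ℚ.1≢0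
linIndep⇒≤ {suc m} {suc k} v v-indep with pivot v
... | p , β , β-clears = s≤s (linIndep⇒≤ reduced (reduced-linIndep v-indep))
  where open Elimination v p β β-clears

linIndep-∷ : ∀ {k m} (v : Fin k → Vec m) (y : Vec m) → LinIndep v →
             (∀ j → dot (v j) y ≡ 0ℚ) → dot y y ≢ 0ℚ → LinIndep (y ∷ v)
linIndep-∷ {k} {m} v y v-indep y⊥v yy≢0 c yv-c≡0 = c≡0
  where
  projection : dot y (lincomb (y ∷ v) c) ≡ dot y y * c zero
  projection = begin
    dot y (lincomb (y ∷ v) c)                                  ≡⟨ dot-lincomb y (y ∷ v) c ⟩
    dot y y * c zero + sumℚ k (λ j → dot y (v j) * c (suc j))  ≡⟨ cong (dot y y * c zero +_) (sumℚ-0 k other-terms) ⟩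
    dot y y * c zero + 0ℚ                                      ≡⟨ ℚ.+-identityʳ _ ⟩
    dot y y * c zero                                           ∎
    where
    open ≡-Reasoning
    other-terms : ∀ j → dot y (v j) * c (suc j) ≡ 0ℚ
    other-terms j = trans (cong (_* c (suc j)) (trans (dot-comm y (v j)) (y⊥v j))) (ℚ.*-zeroˡ (c (suc j)))
  c₀≡0 : c zero ≡ 0ℚ
  c₀≡0 = x≢0∧x*y≡0⇒y≡0 yy≢0 (trans (sym projection)
    (sumℚ-0 m (λ i → trans (cong (y i *_) (yv-c≡0 i)) (ℚ.*-zeroʳ (y i)))))
  v-c≡0 : ∀ i → lincomb v (c ∘ suc) i ≡ 0ℚ
  v-c≡0 i = trans (sym (ℚ.+-identityˡ _))
    (trans (cong (_+ lincomb v (c ∘ suc) i)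
                 (sym (trans (cong (y i *_) c₀≡0) (ℚ.*-zeroʳ (y i)))))
           (yv-c≡0 i))
  c≡0 : ∀ t → c t ≡ 0ℚ
  c≡0 zero    = c₀≡0
  c≡0 (suc j) = v-indep (c ∘ suc) v-c≡0 j

⊥-linIndep⇒≡0 : ∀ {n r} (F : Fin r → Vec n) → LinIndep F → n ℕ.≤ r →
                (y : Vec n) → (∀ j → dot (F j) y ≡ 0ℚ) → ∀ i → y i ≡ 0ℚ
⊥-linIndep⇒≡0 F F-indep n≤r y y⊥F i = ≡-stable λ yᵢ≢0 →
  ℕ.<⇒≱ (linIndep⇒≤ (y ∷ F) (linIndep-∷ F y F-indep y⊥F
          (λ yy≡0 → yᵢ≢0 (dot-self≡0⇒≡0 y yy≡0 i)))) n≤r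

⊥-corank1⇒multiple : ∀ {n r} (F : Fin r → Vec n) → LinIndep F → n ℕ.≤ suc r →
                     (u : Vec n) → dot u u ≢ 0ℚ → (∀ j → dot (F j) u ≡ 0ℚ) →
                     (x : Vec n) → (∀ j → dot (F j) x ≡ 0ℚ) →
                     ∀ i → dot u u * x i ≡ dot u x * u i
⊥-corank1⇒multiple {n} F F-indep n≤1+r u uu≢0 u⊥F x x⊥F i =
  x∙y⁻¹≈ε⇒x≈y _ _ (⊥-linIndep⇒≡0 (u ∷ F) (linIndep-∷ F u F-indep u⊥F uu≢0) n≤1+r y y⊥uF i)
  where
  y : Vec n
  y i = dot u u * x i - dot u x * u i
  dot-y : ∀ w → dot w y ≡ dot u u * dot w x - dot u x * dot w u
  dot-y w = begin
    dot w y                                                    ≡⟨ dot-−ʳ w _ _ ⟩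
    dot w (λ i → dot u u * x i) - dot w (λ i → dot u x * u i)
      ≡⟨ cong₂ _-_ (dot-*ʳ w (dot u u) x) (dot-*ʳ w (dot u x) u) ⟩
    dot u u * dot w x - dot u x * dot w u                      ∎
    where open ≡-Reasoning
  y⊥uF : ∀ t → dot ((u ∷ F) t) y ≡ 0ℚ
  y⊥uF zero    = trans (dot-y u) (trans (cong (_- dot u x * dot u u) (ℚ.*-comm (dot u u) (dot u x)))
                                      (ℚ.+-inverseʳ (dot u x * dot u u)))
  y⊥uF (suc j) = trans (dot-y (F j)) (trans (cong₂ (λ a b → dot u u * a - dot u x * b) (x⊥F j) (u⊥F j))
                                         (vanish (dot u u) (dot u x)))
    where vanish : ∀ a b → a * 0ℚ - b * 0ℚ ≡ 0ℚ
          vanish = solve-∀ ℚ-ring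

-- Matrices

idMat-diag : ∀ {n} (i : Fin n) → idMat n i i ≡ 1ℚ
idMat-diag i with i ≟ i
... | yes _   = refl
... | no i≢i = contradiction refl i≢i

idMat-off : ∀ {n} {i j : Fin n} → i ≢ j → idMat n i j ≡ 0ℚ
idMat-off {i = i} {j} i≢j with i ≟ j
... | yes i≡j = contradiction i≡j i≢j
... | no _    = refl

idMat-permute : ∀ {n} (σ : Permutation′ n) j l → idMat n (σ ⟨$⟩ʳ j) (σ ⟨$⟩ʳ l) ≡ idMat n j l
idMat-permute σ j l with j ≟ l
... | yes refl = idMat-diag (σ ⟨$⟩ʳ j)
... | no j≢l   = idMat-off (j≢l ∘ injective)
  where
  injective : σ ⟨$⟩ʳ j ≡ σ ⟨$⟩ʳ l → j ≡ l
  injective σj≡σl = trans (sym (inverseˡ σ)) (trans (cong (σ ⟨$⟩ˡ_) σj≡σl) (inverseˡ σ))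

⊙-cong : ∀ {m k} (M : Mat m k) {x y : Vec k} → (∀ i → x i ≡ y i) → ∀ i → (M ⊙ x) i ≡ (M ⊙ y) i
⊙-cong {k = k} M x≗y i = sumℚ-cong k (λ t → cong (M i t *_) (x≗y t))

≋-⊙ : ∀ {m k} {M N : Mat m k} → M ≋ N → ∀ x i → (M ⊙ x) i ≡ (N ⊙ x) i
≋-⊙ {k = k} M≋N x i = sumℚ-cong k (λ t → cong (_* x t) (M≋N i t))

·-⊙-assoc : ∀ {m k l} (M : Mat m k) (N : Mat k l) (x : Vec l) i →
            ((M · N) ⊙ x) i ≡ (M ⊙ (N ⊙ x)) i
·-⊙-assoc {k = k} {l} M N x i = begin
  sumℚ l (λ t → sumℚ k (λ u → M i u * N u t) * x t)     ≡⟨ sumℚ-cong l (λ t → sumℚ-*ʳ k (x t) _) ⟩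
  sumℚ l (λ t → sumℚ k (λ u → (M i u * N u t) * x t))   ≡⟨ sumℚ-comm l k _ ⟩
  sumℚ k (λ u → sumℚ l (λ t → (M i u * N u t) * x t))   ≡⟨ sumℚ-cong k (λ u → sumℚ-cong l (λ t →
                                                             ℚ.*-assoc (M i u) (N u t) (x t))) ⟩
  sumℚ k (λ u → sumℚ l (λ t → M i u * (N u t * x t)))   ≡⟨ sumℚ-cong k (λ u → sumℚ-*ˡ l (M i u) _) ⟨
  (M ⊙ (N ⊙ x)) i                                        ∎
  where open ≡-Reasoning

idMat-⊙ : ∀ {n} (x : Vec n) k → (idMat n ⊙ x) k ≡ x k
idMat-⊙ {n} x k = begin
  (idMat n ⊙ x) k      ≡⟨ sumℚ-single n k _ (λ l l≢k →
                            trans (cong (_* x l) (idMat-off (l≢k ∘ sym))) (ℚ.*-zeroˡ (x l))) ⟩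
  idMat n k k * x k    ≡⟨ cong (_* x k) (idMat-diag k) ⟩
  1ℚ * x k             ≡⟨ ℚ.*-identityˡ (x k) ⟩
  x k                  ∎
  where open ≡-Reasoning

·-permMat : ∀ {n} (M : Mat n n) (π : Permutation′ n) → (M · permMat π) ≋ (λ i j → M i (π ⟨$⟩ʳ j))
·-permMat {n} M π i j = begin
  (M · permMat π) i j                   ≡⟨ sumℚ-single n (π ⟨$⟩ʳ j) _ (λ t t≢πj →
                                             trans (cong (M i t *_) (idMat-off t≢πj)) (ℚ.*-zeroʳ (M i t))) ⟩
  M i (π ⟨$⟩ʳ j) * permMat π (π ⟨$⟩ʳ j) j ≡⟨ cong (M i (π ⟨$⟩ʳ j) *_) (idMat-diag (π ⟨$⟩ʳ j)) ⟩
  M i (π ⟨$⟩ʳ j) * 1ℚ                   ≡⟨ ℚ.*-identityʳ _ ⟩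
  M i (π ⟨$⟩ʳ j)                        ∎
  where open ≡-Reasoning

gram-cong : ∀ {n} {Q Q′ : Mat n n} → Q ≋ Q′ → (transpose Q · Q) ≋ (transpose Q′ · Q′)
gram-cong {n} Q≋Q′ i j = sumℚ-cong n (λ t → cong₂ _*_ (Q≋Q′ t i) (Q≋Q′ t j))

conjugate-cong : ∀ {n} (M : Mat n n) {Q Q′ : Mat n n} → Q ≋ Q′ →
                 ((transpose Q · M) · Q) ≋ ((transpose Q′ · M) · Q′)
conjugate-cong {n} M Q≋Q′ i j =
  sumℚ-cong n (λ t → cong₂ _*_ (sumℚ-cong n (λ u → cong (_* M u t) (Q≋Q′ u i))) (Q≋Q′ t j))

module Orthogonal {n} (Q : Mat n n) (QᵀQ≋I : (transpose Q · Q) ≋ idMat n) where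

  Qᵀ⊙Q⊙ : ∀ x k → (transpose Q ⊙ (Q ⊙ x)) k ≡ x k
  Qᵀ⊙Q⊙ x k = trans (sym (·-⊙-assoc (transpose Q) Q x k)) (trans (≋-⊙ QᵀQ≋I x k) (idMat-⊙ x k))

  columns-linIndep : LinIndep (col Q)
  columns-linIndep c Qc≡0 k = trans (sym (Qᵀ⊙Q⊙ c k))
    (sumℚ-0 n (λ t → trans (cong (Q t k *_) (Qc≡0 t)) (ℚ.*-zeroʳ (Q t k))))

  Q⊙Qᵀ⊙ : ∀ x i → (Q ⊙ (transpose Q ⊙ x)) i ≡ x i
  Q⊙Qᵀ⊙ x i = sym (x∙y⁻¹≈ε⇒x≈y _ _ (⊥-linIndep⇒≡0 (col Q) columns-linIndep ℕ.≤-refl y y⊥Q i))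
    where
    y : Vec n
    y i = x i - (Q ⊙ (transpose Q ⊙ x)) i
    y⊥Q : ∀ l → dot (col Q l) y ≡ 0ℚ
    y⊥Q l = trans (dot-−ʳ (col Q l) x _) (x≈y⇒x∙y⁻¹≈ε (sym (Qᵀ⊙Q⊙ (transpose Q ⊙ x) l)))

rankOneUpdate : ∀ {n} → Mat n n → Vec n → Vec n → Mat n n
rankOneUpdate Q u a s j = Q s j + a j * u s

-- With v = Qᵀu, the identity (Q + u aᵀ)ᵀ(Q + u aᵀ) = QᵀQ reads a vᵀ + v aᵀ + (u·u) a aᵀ = 0.
rankOneUpdate-gram : ∀ {n} (Q : Mat n n) (u a : Vec n) →
  (transpose Q · Q) ≋ idMat n →
  (transpose (rankOneUpdate Q u a) · rankOneUpdate Q u a) ≋ idMat n →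
  ∀ j l → a l * dot (col Q j) u + a j * dot (col Q l) u + a j * a l * dot u u ≡ 0ℚ
rankOneUpdate-gram {n} Q u a QᵀQ≋I Q′ᵀQ′≋I j l = identityʳ-unique (idMat n j l) _ (begin
  idMat n j l + (a l * v j + a j * v l + a j * a l * N)
    ≡⟨ regroup (idMat n j l) (a l * v j) (a j * v l) (a j * a l) N ⟩
  idMat n j l + a l * v j + a j * v l + (a j * a l) * N
    ≡⟨ cong (λ d → d + a l * v j + a j * v l + (a j * a l) * N) (QᵀQ≋I j l) ⟨
  sumℚ n (λ s → Q s j * Q s l) + a l * v j + a j * v l + (a j * a l) * N
    ≡⟨ expand ⟨
  sumℚ n (λ s → Q s j * Q s l + a l * (Q s j * u s) + a j * (Q s l * u s) + (a j * a l) * (u s * u s))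
    ≡⟨ sumℚ-cong n (λ s → product (Q s j) (Q s l) (a j) (a l) (u s)) ⟨
  sumℚ n (λ s → (Q s j + a j * u s) * (Q s l + a l * u s))
    ≡⟨ Q′ᵀQ′≋I j l ⟩
  idMat n j l ∎)
  where
  open ≡-Reasoning
  N = dot u u
  v : Vec n
  v j = dot (col Q j) u
  regroup : ∀ d x y z N → d + (x + y + z * N) ≡ d + x + y + z * N
  regroup = solve-∀ ℚ-ring
  product : ∀ p q b c w → (p + b * w) * (q + c * w) ≡ p * q + c * (p * w) + b * (q * w) + (b * c) * (w * w)
  product = solve-∀ ℚ-ring
  expand = trans (sumℚ-+-* n (a j * a l) _ _) (cong (_+ (a j * a l) * N)
             (trans (sumℚ-+-* n (a j) _ _) (cong (_+ a j * v l) (sumℚ-+-* n (a l) _ _))))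

-- The diagonal of the Gram identity gives aⱼ = 0 or (u·u) aⱼ = -2vⱼ; in the first case
-- an entry (j, k) with aₖ ≠ 0 forces vⱼ = 0.
rankOneUpdate-orthogonal : ∀ {n} (Q : Mat n n) (u a : Vec n) →
  (transpose Q · Q) ≋ idMat n →
  (transpose (rankOneUpdate Q u a) · rankOneUpdate Q u a) ≋ idMat n →
  ¬ (∀ j → a j ≡ 0ℚ) → ∀ j → dot u u * a j ≡ - (dot (col Q j) u + dot (col Q j) u)
rankOneUpdate-orthogonal {n} Q u a QᵀQ≋I Q′ᵀQ′≋I a≢0 j = determined (a j ℚ.≟ 0ℚ)
  where
  open ≡-Reasoning
  N = dot u u
  v : Vec n
  v j = dot (col Q j) u
  gram = rankOneUpdate-gram Q u a QᵀQ≋I Q′ᵀQ′≋I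
  k = proj₁ (¬∀⟶∃¬ n _ (λ j → a j ℚ.≟ 0ℚ) a≢0)
  aₖ≢0 = proj₂ (¬∀⟶∃¬ n _ (λ j → a j ℚ.≟ 0ℚ) a≢0)
  diagonal : ∀ a v N → a * (v + v + N * a) ≡ a * v + a * v + a * a * N
  diagonal = solve-∀ ℚ-ring
  drop : ∀ a v w N → a * v + 0ℚ * w + 0ℚ * a * N ≡ a * v
  drop = solve-∀ ℚ-ring
  determined : Dec (a j ≡ 0ℚ) → N * a j ≡ - (v j + v j)
  determined (no aⱼ≢0) = inverseʳ-unique (v j + v j) (N * a j)
    (x≢0∧x*y≡0⇒y≡0 aⱼ≢0 (trans (diagonal (a j) (v j) N) (gram j j)))
  determined (yes aⱼ≡0) = begin
    N * a j                ≡⟨ cong (N *_) aⱼ≡0 ⟩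
    N * 0ℚ                 ≡⟨ ℚ.*-zeroʳ N ⟩
    - (0ℚ + 0ℚ)            ≡⟨ cong (λ w → - (w + w)) vⱼ≡0 ⟨
    - (v j + v j)          ∎
    where
    vⱼ≡0 : v j ≡ 0ℚ
    vⱼ≡0 = x≢0∧x*y≡0⇒y≡0 aₖ≢0 (begin
      a k * v j                                   ≡⟨ drop (a k) (v j) (v k) N ⟨
      a k * v j + 0ℚ * v k + 0ℚ * a k * N         ≡⟨ cong (λ w → a k * v j + w * v k + w * a k * N) aⱼ≡0 ⟨
      a k * v j + a j * v k + a j * a k * N       ≡⟨ gram j k ⟩
      0ℚ                                          ∎)

-- Solutions of Qᵀ A(G) Q = A(H)

IsSolution : ∀ {n} → Graph n → Graph n → Mat n n → Set
IsSolution G H Q = RegularOrthogonal Q × ((transpose Q · A G) · Q) ≋ A H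

module Solution {n} {G H : Graph n} {Q : Mat n n} (sol : IsSolution G H Q) where

  open Orthogonal Q (proj₁ (proj₁ sol))

  intertwines : ∀ x i → (Q ⊙ (A H ⊙ x)) i ≡ (A G ⊙ (Q ⊙ x)) i
  intertwines x i = trans (⊙-cong Q Qᵀ⊙AG⊙Q⊙ i) (Q⊙Qᵀ⊙ _ i)
    where
    open ≡-Reasoning
    Qᵀ⊙AG⊙Q⊙ : ∀ j → (A H ⊙ x) j ≡ (transpose Q ⊙ (A G ⊙ (Q ⊙ x))) j
    Qᵀ⊙AG⊙Q⊙ j = begin
      (A H ⊙ x) j                          ≡⟨ ≋-⊙ (proj₂ sol) x j ⟨
      (((transpose Q · A G) · Q) ⊙ x) j    ≡⟨ ·-⊙-assoc (transpose Q · A G) Q x j ⟩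
      ((transpose Q · A G) ⊙ (Q ⊙ x)) j    ≡⟨ ·-⊙-assoc (transpose Q) (A G) (Q ⊙ x) j ⟩
      (transpose Q ⊙ (A G ⊙ (Q ⊙ x))) j    ∎

  ⊙-walk : ∀ k i → (Q ⊙ powApply (A H) k (ones n)) i ≡ powApply (A G) k (ones n) i
  ⊙-walk zero    i = proj₂ (proj₁ sol) i
  ⊙-walk (suc k) i = trans (intertwines _ i) (⊙-cong (A G) (⊙-walk k) i)

  transpose-⊙-walk : ∀ k j → (transpose Q ⊙ powApply (A G) k (ones n)) j ≡ powApply (A H) k (ones n) j
  transpose-⊙-walk k j = trans (⊙-cong (transpose Q) (λ i → sym (⊙-walk k i)) j) (Qᵀ⊙Q⊙ _ j)

walks⊥solution-difference : ∀ {n} (G H : Graph n) {Q Q′ : Mat n n} →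
  IsSolution G H Q → IsSolution G H Q′ → ∀ k j → dot (col (W G) k) (λ s → Q′ s j - Q s j) ≡ 0ℚ
walks⊥solution-difference G H {Q} {Q′} sol sol′ k j = begin
  dot w (λ s → Q′ s j - Q s j)          ≡⟨ dot-−ʳ w (col Q′ j) (col Q j) ⟩
  dot w (col Q′ j) - dot w (col Q j)    ≡⟨ cong₂ _-_ (dot-comm w (col Q′ j)) (dot-comm w (col Q j)) ⟩
  dot (col Q′ j) w - dot (col Q j) w    ≡⟨ cong₂ _-_ (Solution.transpose-⊙-walk {G = G} {H} sol′ (toℕ k) j)
                                                     (Solution.transpose-⊙-walk {G = G} {H} sol (toℕ k) j) ⟩
  W H j k - W H j k                     ≡⟨ ℚ.+-inverseʳ (W H j k) ⟩
  0ℚ                                    ∎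
  where
  open ≡-Reasoning
  w = col (W G) k

module TwoSolutions {n} (G H : Graph n) (G-ac : AlmostControllable G) {Q₁ Q₂ : Mat n n}
                    (sol₁ : IsSolution G H Q₁) (sol₂ : IsSolution G H Q₂) (Q₁≉Q₂ : ¬ Q₁ ≋ Q₂) where

  private
    walk-columns : Fin (n ∸ 1) → Fin n
    walk-columns = proj₁ (proj₁ G-ac)

    F : Fin (n ∸ 1) → Vec n
    F l = col (W G) (walk-columns l)

    differing-column : ∃ λ j → ¬ (∀ s → Q₁ s j ≡ Q₂ s j)
    differing-column = ¬∀⟶∃¬ n _ (λ j → all? (λ s → Q₁ s j ℚ.≟ Q₂ s j))
      (λ same → Q₁≉Q₂ (λ s j → same j s))

    j₀ : Fin n
    j₀ = proj₁ differing-column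

    u : Vec n
    u s = Q₂ s j₀ - Q₁ s j₀

    uu≢0 : dot u u ≢ 0ℚ
    uu≢0 uu≡0 = proj₂ differing-column (λ s → sym (x∙y⁻¹≈ε⇒x≈y _ _ (dot-self≡0⇒≡0 u uu≡0 s)))

    instance _ = ≢-nonZero uu≢0

    module _ {Q : Mat n n} (sol : IsSolution G H Q) where

      a : Vec n
      a j = dot u (λ s → Q s j - Q₁ s j) * 1/ dot u u

      ≋rankOneUpdate : Q ≋ rankOneUpdate Q₁ u a
      ≋rankOneUpdate s j = begin
        Q s j                                ≡⟨ split (Q s j) (Q₁ s j) ⟩
        Q₁ s j + (Q s j - Q₁ s j)            ≡⟨ cong (Q₁ s j +_) (x*y≡z⇒y≡z*1/x (dot u u) multiple) ⟩
        Q₁ s j + d * u s * 1/ dot u u        ≡⟨ cong (Q₁ s j +_) (swap d (u s) (1/ dot u u)) ⟩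
        Q₁ s j + a j * u s                   ∎
        where
        open ≡-Reasoning
        d = dot u (λ s → Q s j - Q₁ s j)
        multiple : dot u u * (Q s j - Q₁ s j) ≡ d * u s
        multiple = ⊥-corank1⇒multiple F (proj₂ (proj₁ G-ac)) (ℕ.m≤n+m∸n n 1)
          u uu≢0 (λ l → walks⊥solution-difference G H sol₁ sol₂ (walk-columns l) j₀)
          (λ s → Q s j - Q₁ s j) (λ l → walks⊥solution-difference G H sol₁ sol (walk-columns l) j) s
        split : ∀ q p → q ≡ p + (q - p)
        split = solve-∀ ℚ-ring
        swap : ∀ d w r → d * w * r ≡ d * r * w
        swap = solve-∀ ℚ-ring

      a-determined : ¬ Q₁ ≋ Q → ∀ j → dot u u * a j ≡ - (dot (col Q₁ j) u + dot (col Q₁ j) u)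
      a-determined Q₁≉Q = rankOneUpdate-orthogonal Q₁ u a (proj₁ (proj₁ sol₁))
        (λ j l → trans (gram-cong (λ s j → sym (≋rankOneUpdate s j)) j l) (proj₁ (proj₁ sol) j l))
        (λ a≡0 → Q₁≉Q (λ s j → sym (trans (≋rankOneUpdate s j)
          (trans (cong (λ c → Q₁ s j + c * u s) (a≡0 j))
            (trans (cong (Q₁ s j +_) (ℚ.*-zeroˡ (u s))) (ℚ.+-identityʳ (Q₁ s j)))))))

  solution≉Q₁⇒≋Q₂ : ∀ {Q} → IsSolution G H Q → ¬ Q₁ ≋ Q → Q₂ ≋ Q
  solution≉Q₁⇒≋Q₂ {Q} sol Q₁≉Q s j = begin
    Q₂ s j                        ≡⟨ ≋rankOneUpdate sol₂ s j ⟩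
    Q₁ s j + a sol₂ j * u s       ≡⟨ cong (λ c → Q₁ s j + c * u s) (*-cancelˡ-≢0 uu≢0
                                       (trans (a-determined sol₂ Q₁≉Q₂ j) (sym (a-determined sol Q₁≉Q j)))) ⟩
    Q₁ s j + a sol j * u s        ≡⟨ ≋rankOneUpdate sol s j ⟨
    Q s j                         ∎
    where open ≡-Reasoning

-- Column permutations and automorphisms

boolℚ-injective : ∀ {b c} → boolℚ b ≡ boolℚ c → b ≡ c
boolℚ-injective {true}  {true}  _ = refl
boolℚ-injective {true}  {false} 1≡0 = contradiction 1≡0 ℚ.1≢0
boolℚ-injective {false} {true}  0≡1 = contradiction (sym 0≡1) ℚ.1≢0
boolℚ-injective {false} {false} _ = refl

module _ {n} {Q : Mat n n} (σ : Permutation′ n) where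

  private
    Qσ : Mat n n
    Qσ i j = Q i (σ ⟨$⟩ʳ j)

  permute-solution : ∀ {G H : Graph n} → IsSolution G H Q → IsAutomorphism H σ → IsSolution G H Qσ
  permute-solution ((QᵀQ≋I , Q⊙e≡e) , QᵀAQ≋A) σ-aut =
    ( (λ j l → trans (QᵀQ≋I _ _) (idMat-permute σ j l))
    , (λ i → trans (sym (sumℚ-permute n (λ j → Q i j * 1ℚ) σ)) (Q⊙e≡e i)) )
    , λ i j → trans (QᵀAQ≋A _ _) (cong boolℚ (σ-aut i j))

  permuted-solution⇒automorphism : ∀ {G H : Graph n} →
    ((transpose Q · A G) · Q) ≋ A H → ((transpose Qσ · A G) · Qσ) ≋ A H → IsAutomorphism H σ
  permuted-solution⇒automorphism QᵀAQ≋A QσᵀAQσ≋A i j =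
    boolℚ-injective (trans (sym (QᵀAQ≋A _ _)) (QσᵀAQσ≋A i j))

  permute-≉ : (transpose Q · Q) ≋ idMat n → ∀ {i} → σ ⟨$⟩ʳ i ≢ i → ¬ Q ≋ Qσ
  permute-≉ QᵀQ≋I {i} σi≢i Q≋Qσ = ℚ.1≢0 (begin
    1ℚ                                    ≡⟨ idMat-diag i ⟨
    idMat n i i                           ≡⟨ QᵀQ≋I i i ⟨
    sumℚ n (λ t → Q t i * Q t i)          ≡⟨ sumℚ-cong n (λ t → cong (Q t i *_) (Q≋Qσ t i)) ⟩
    sumℚ n (λ t → Q t i * Q t (σ ⟨$⟩ʳ i)) ≡⟨ QᵀQ≋I i (σ ⟨$⟩ʳ i) ⟩
    idMat n i (σ ⟨$⟩ʳ i)                  ≡⟨ idMat-off (σi≢i ∘ sym) ⟩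
    0ℚ                                    ∎)
    where open ≡-Reasoning

-- Only the almost controllability of G enters.
lemma15 : ∀ {n : ℕ} (G H : Graph n) →
          AlmostControllable G → AlmostControllable H →
          SameGeneralizedSpectrum G H →
          (Q₁ Q₂ : Mat n n) →
          RegularOrthogonal Q₁ → RegularOrthogonal Q₂ →
          ((transpose Q₁ · A G) · Q₁) ≋ A H →
          ((transpose Q₂ · A G) · Q₂) ≋ A H →
          ¬ (Q₁ ≋ Q₂) →
          (ColumnPermutationEquivalent Q₁ Q₂ ⇔ Symmetric H)
lemma15 {n} G H G-ac _ _ Q₁ Q₂ reg₁ reg₂ sol₁ sol₂ Q₁≉Q₂ = mk⇔ to from
  where
  to : ColumnPermutationEquivalent Q₁ Q₂ → Symmetric H
  to (π , Q₂≋Q₁P) = π , π-aut , π-moves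
    where
    Q₂≋Q₁π : Q₂ ≋ (λ s j → Q₁ s (π ⟨$⟩ʳ j))
    Q₂≋Q₁π s j = trans (Q₂≋Q₁P s j) (·-permMat Q₁ π s j)
    π-aut : IsAutomorphism H π
    π-aut = permuted-solution⇒automorphism π {G} {H} sol₁
      (λ i j → trans (conjugate-cong (A G) (λ s j → sym (Q₂≋Q₁π s j)) i j) (sol₂ i j))
    π-moves : ∃ λ i → π ⟨$⟩ʳ i ≢ i
    π-moves = ¬∀⟶∃¬ n _ (λ i → π ⟨$⟩ʳ i ≟ i)
      (λ π-fixes → Q₁≉Q₂ (λ s j → trans (cong (Q₁ s) (sym (π-fixes j))) (sym (Q₂≋Q₁π s j))))
  from : Symmetric H → ColumnPermutationEquivalent Q₁ Q₂
  from (σ , σ-aut , i , σi≢i) = σ , λ s j → trans (Q₂≋Q₁σ s j) (sym (·-permMat Q₁ σ s j))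
    where
    open TwoSolutions G H G-ac (reg₁ , sol₁) (reg₂ , sol₂) Q₁≉Q₂
    Q₂≋Q₁σ : Q₂ ≋ (λ s j → Q₁ s (σ ⟨$⟩ʳ j))
    Q₂≋Q₁σ = solution≉Q₁⇒≋Q₂ (permute-solution σ {G} {H} (reg₁ , sol₁) σ-aut) (permute-≉ σ (proj₁ reg₁) σi≢i)
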